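{- Let $X$ be a set and $R\subseteq X\times X$ be a co-confluent collusion. Then the protection relation $\sqsupset_R$ induced by $R$ is a collusion.
   Context: For a binary relation $S$ on $X$: $S$ is collusive iff $\forall x,y,z,w\in X\,\big((xSy \wedge xSz \wedge wSy)\Rightarrow wSz\big)$; $S$ is total iff $\forall x\,\exists y.\ xSy$; $S$ is surjective iff $\forall x\,\exists y.\ ySx$; $S$ is a collusion iff it is collusive, total and surjective. $R$ is co-confluent iff $\forall x,y,z,w\in X\,\big((xRy \wedge zRx \wedge wRy)\Rightarrow zRw\big)$. The protection relation induced by $R$ is defined by $x \sqsupset_R z$ iff $\forall y\in X\,(yRz \Rightarrow xRy)$. -}

module Defs where

open import Level using (Level; _⊔_)
open import Data.Product using (_×_; ∃; ∃-syntax)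
open import Relation.Binary.Core using (Rel)

Collusive : ∀ {a ℓ} {X : Set a} → Rel X ℓ → Set (a ⊔ ℓ)
Collusive {X = X} S = ∀ (x y z w : X) → S x y → S x z → S w y → S w z

Total : ∀ {a ℓ} {X : Set a} → Rel X ℓ → Set (a ⊔ ℓ)
Total {X = X} S = ∀ (x : X) → ∃[ y ] S x y

Surjective : ∀ {a ℓ} {X : Set a} → Rel X ℓ → Set (a ⊔ ℓ)
Surjective {X = X} S = ∀ (x : X) → ∃[ y ] S y x

Collusion : ∀ {a ℓ} {X : Set a} → Rel X ℓ → Set (a ⊔ ℓ)
Collusion S = Collusive S × Total S × Surjective S

CoConfluent : ∀ {a ℓ} {X : Set a} → Rel X ℓ → Set (a ⊔ ℓ)
CoConfluent {X = X} R = ∀ (x y z w : X) → R x y → R z x → R w y → R z w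

Protection : ∀ {a ℓ} {X : Set a} → Rel X ℓ → Rel X (a ⊔ ℓ)
Protection {X = X} R x z = ∀ (y : X) → R y z → R x y

-- A total R gives a path x R m R b, a surjective R a path x R u R z; in both
-- cases co-confluence says the endpoints satisfy x ⊐R b (resp. x ⊐R z).
-- Collusiveness transfers from R to ⊐R through any R-predecessor of y.
module Submission where

open import Defs
open import Relation.Binary.Core using (Rel)
open import Data.Product using (_,_)

module _ {a ℓ} {X : Set a} {R : Rel X ℓ} where

  protection-collusive : Surjective R → Collusive R → Collusive (Protection R)
  protection-collusive sur col x y z w x⊐y x⊐z w⊐y v vRz =
    let u , uRy = sur y in
    col x u v w (x⊐y u uRy) (x⊐z v vRz) (w⊐y u uRy)

  protection-total : CoConfluent R → Total R → Total (Protection R)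
  protection-total cc tot x =
    let m , xRm = tot x
        b , mRb = tot m
    in b , λ v vRb → cc m b x v mRb xRm vRb

  protection-surjective : CoConfluent R → Surjective R → Surjective (Protection R)
  protection-surjective cc sur z =
    let u , uRz = sur z
        x , xRu = sur u
    in x , λ v vRz → cc u z x v uRz xRu vRz

mainTheorem3 : ∀ {a ℓ} {X : Set a} (R : Rel X ℓ) → CoConfluent R → Collusion R → Collusion (Protection R)
mainTheorem3 R cc (col , tot , sur) =
  protection-collusive sur col , protection-total cc tot , protection-surjective cc sur
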